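{- Let $p,h$ be positive integers. The number of stable monomial ideals $J\triangleleft\mathbf k[x_1,x_2]$ with $\mathsf N(J)$ finite such that the Bar Code of $\mathsf N(J)$ has bar list $(p,h)$ equals the number of integer partitions of $p$ into $h$ distinct (positive) parts, i.e. the number of $(\alpha_1,\dots,\alpha_h)\in\mathbb N^h$ with $\alpha_1>\dots>\alpha_h>0$ and $\sum_j\alpha_j=p$.
   Context: $\mathbf k$ is a field of characteristic $0$, $x_1<x_2$, terms ordered lexicographically ($x_1^a x_2^b<x_1^cx_2^d$ iff $b<d$, or $b=d$ and $a<c$). A monomial ideal $J$ is stable if for every term $\tau\in J$ and every variable $x_j>\min(\tau)$ (the smallest variable dividing $\tau$), $x_j\tau/\min(\tau)\in J$. $\mathsf N(J)$ is the set of terms not in $J$. For $\tau=x_1^{\gamma_1}x_2^{\gamma_2}$, $P_{x_1}(\tau)=\tau$, $P_{x_2}(\tau)=x_2^{\gamma_2}$. Bar Code of a finite set $M=\{\tau_1<\dots<\tau_m\}$: the $i$-th row is the sequence $P_{x_i}(\tau_1),\dots,P_{x_i}(\tau_m)$, and each maximal run of consecutive equal entries is an $i$-bar; $\mu(i)$ is the number of $i$-bars and the bar list is $(\mu(1),\mu(2))$. (Thus $\mu(1)=|M|$ and $\mu(2)$ is the number of distinct $x_2$-degrees in $M$.) -}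

module Defs where

open import Data.Nat using (ℕ; zero; suc; _<_; _≟_)
open import Data.Bool using (Bool; true; false; if_then_else_)
open import Data.Product using (Σ; ∃; _×_; _,_; proj₁; proj₂)
open import Data.Product.Properties using (≡-dec)
open import Data.List using (List; []; _∷_; _++_; map; concatMap; upTo; filter)
open import Data.Vec using (Vec; lookup; sum)
open import Data.Fin using (Fin) renaming (_<_ to _<ᶠ_)
open import Relation.Nullary using (Dec; yes; no; does; ¬_)
open import Relation.Binary using (Setoid; DecidableEquality)
open import Relation.Binary.PropositionalEquality using (_≡_; refl; sym; trans)
open import Data.Bool.Properties using (T?)
open import Level using (0ℓ)

-- Terms of k[x₁,x₂]:  x₁^a x₂^b  is represented by the pair (a , b).
-- A monomial ideal J is represented by its (decidable) set of terms,
-- a membership function  J a b = true  iff  x₁^a x₂^b ∈ J.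
-- (A monomial ideal is determined by the terms it contains; the field k
-- plays no role.)

TermSet : Set
TermSet = ℕ → ℕ → Bool

IsMonomialIdeal : TermSet → Set
IsMonomialIdeal J =
  ∀ a b → J a b ≡ true → (J (suc a) b ≡ true) × (J a (suc b) ≡ true)

-- Stability: for τ = x₁^a x₂^b ∈ J and x_j > min(τ).
-- If a > 0 then min(τ) = x₁ and the only larger variable is x₂,
-- giving x₂ τ / x₁ ∈ J.  If a = 0 (and b > 0) then min(τ) = x₂ and the
-- condition is vacuous (likewise for τ = 1, which has no variables).
IsStable : TermSet → Set
IsStable J = ∀ a b → J (suc a) b ≡ true → J a (suc b) ≡ true

BoundedBy : TermSet → ℕ → Set
BoundedBy J B = ∀ a b → J a b ≡ false → (a < B) × (b < B)

-- The terms of N(J) with exponents < B, listed in increasing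
-- lexicographic order (x₁ < x₂: compare x₂-degree first, then x₁-degree).
outsideUpTo : TermSet → ℕ → List (ℕ × ℕ)
outsideUpTo J B =
  concatMap (λ b → concatMap (λ a → if J a b then [] else (a , b) ∷ []) (upTo B)) (upTo B)

P₁ : ℕ × ℕ → ℕ × ℕ
P₁ τ = τ

P₂ : ℕ × ℕ → ℕ
P₂ τ = proj₂ τ

runsFrom : {A : Set} → DecidableEquality A → A → List A → ℕ
runsFrom _≟'_ x [] = 0
runsFrom _≟'_ x (y ∷ ys) with x ≟' y
... | yes _ = runsFrom _≟'_ y ys
... | no  _ = suc (runsFrom _≟'_ y ys)

runs : {A : Set} → DecidableEquality A → List A → ℕ
runs _≟'_ [] = 0
runs _≟'_ (x ∷ xs) = suc (runsFrom _≟'_ x xs)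

barList : List (ℕ × ℕ) → ℕ × ℕ
barList M = runs (≡-dec _≟_ _≟_) (map P₁ M) , runs _≟_ (map P₂ M)

HasFiniteNWithBarList : TermSet → ℕ → ℕ → Set
HasFiniteNWithBarList J p h =
  Σ ℕ λ B → BoundedBy J B × (barList (outsideUpTo J B) ≡ (p , h))

StableIdeal : ℕ → ℕ → Set
StableIdeal p h =
  Σ TermSet λ J → IsMonomialIdeal J × IsStable J × HasFiniteNWithBarList J p h

StableIdealSetoid : ℕ → ℕ → Setoid 0ℓ 0ℓ
StableIdealSetoid p h = record
  { Carrier = StableIdeal p h
  ; _≈_ = λ I J → ∀ a b → proj₁ I a b ≡ proj₁ J a b
  ; isEquivalence = record
    { refl = λ a b → refl
    ; sym = λ e a b → sym (e a b)
    ; trans = λ e f a b → trans (e a b) (f a b)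
    }
  }

DistinctPartition : ℕ → ℕ → Set
DistinctPartition p h =
  Σ (Vec ℕ h) λ α →
    (∀ (i j : Fin h) → i <ᶠ j → lookup α j < lookup α i)
    × (∀ (i : Fin h) → 0 < lookup α i)
    × (sum α ≡ p)

DistinctPartitionSetoid : ℕ → ℕ → Setoid 0ℓ 0ℓ
DistinctPartitionSetoid p h = record
  { Carrier = DistinctPartition p h
  ; _≈_ = λ α β → proj₁ α ≡ proj₁ β
  ; isEquivalence = record
    { refl = refl
    ; sym = sym
    ; trans = trans
    }
  }

-- A stable ideal J with N(J) finite is a staircase: row b of N(J) is {x₁^a x₂^b : a < t b},
-- and being a monomial ideal that is stable says exactly that the nonzero row lengths t 0, t 1, …
-- strictly decrease.  Listing N(J) row by row, every term is its own 1-bar and each nonempty row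
-- is one 2-bar, so the bar list is (Σ t b , number of nonempty rows).  Hence J ↦ (t 0, …, t (h-1))
-- is a bijection onto the partitions of p into h distinct parts.
module Submission where

open import Defs
open import Data.Nat using (ℕ; zero; suc; _+_; _≤_; _<_; _≤ᵇ_; _≡ᵇ_; _≟_; z≤n; s≤s)
open import Data.Nat.Properties
  using (≤ᵇ⇒≤; ≤⇒≤ᵇ; ≤-refl; ≤-reflexive; ≤-trans; ≤-antisym; ≤-pred; <-trans; <⇒≱; ≰⇒>;
         1+n≰n; n≮0; n≤0⇒n≡0; m≤n⇒m≤1+n; m≤n⇒m<n∨m≡n; m≤m+n; m≤n+m; 0≢1+n; suc-injective)
open import Data.Nat.ListAction using (sum)
open import Data.Bool using (Bool; true; false; if_then_else_)
open import Data.Bool.Properties using (T-≡)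
open import Data.Product using (Σ; _×_; _,_; proj₁; proj₂; map₂)
open import Data.Sum using (_⊎_; inj₁; inj₂)
open import Data.Empty using (⊥-elim)
open import Data.List using (List; []; _∷_; _++_; map; concat; concatMap; applyUpTo; upTo)
open import Data.List.Properties
  using (map-applyUpTo; map-upTo; map-++; map-∘; map-id; concatMap-cong; concatMap-map; map-concatMap)
open import Data.List.Relation.Unary.Any using (here)
open import Data.List.Membership.Propositional.Properties using (∈-map⁻; ∈-applyUpTo⁻)
open import Data.List.Relation.Binary.Disjoint.Propositional using (Disjoint; contractₗ)
open import Data.Vec using (Vec; []; _∷_; lookup; tabulate)
import Data.Vec as Vec
open import Data.Vec.Properties using (tabulate-cong; lookup∘tabulate)
open import Data.Fin using (toℕ) renaming (zero to fzero; suc to fsuc; _<_ to _<ᶠ_)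
open import Data.Fin.Properties using (toℕ<n)
open import Relation.Nullary using (yes; no)
open import Relation.Binary using (Setoid; DecidableEquality)
open import Relation.Binary.PropositionalEquality
  using (_≡_; _≢_; refl; sym; trans; cong; cong₂; subst; _→-setoid_; module ≡-Reasoning)
import Relation.Binary.Construct.On as On
open import Function using (_∘_; case_of_; Injective; Equivalence)
open import Level using (0ℓ)
open import Function.Bundles using (Bijection)
open import Function.Construct.Composition using (bijection)
open import Function.Consequences.Setoid using (strictlySurjective⇒surjective)

≤ᵇ≡true⇒≤ : ∀ {m n} → (m ≤ᵇ n) ≡ true → m ≤ n
≤ᵇ≡true⇒≤ {m} {n} e = ≤ᵇ⇒≤ m n (Equivalence.from T-≡ e)

≤⇒≤ᵇ≡true : ∀ {m n} → m ≤ n → (m ≤ᵇ n) ≡ true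
≤⇒≤ᵇ≡true m≤n = Equivalence.to T-≡ (≤⇒≤ᵇ m≤n)

≤ᵇ-suc : ∀ m n → (suc m ≤ᵇ suc n) ≡ (m ≤ᵇ n)
≤ᵇ-suc zero n = refl
≤ᵇ-suc (suc m) n = refl

≤ᵇ≡false⇒> : ∀ {m n} → (m ≤ᵇ n) ≡ false → n < m
≤ᵇ≡false⇒> e = ≰⇒> λ m≤n → case trans (sym e) (≤⇒≤ᵇ≡true m≤n) of λ ()

UpClosed : (ℕ → Bool) → Set
UpClosed P = ∀ a → P a ≡ true → P (suc a) ≡ true

Threshold : (ℕ → Bool) → ℕ → Set
Threshold P r = ∀ a → P a ≡ (r ≤ᵇ a)

threshold-≤ : ∀ {P r s} → Threshold P r → Threshold P s → s ≤ r
threshold-≤ {r = r} θr θs = ≤ᵇ≡true⇒≤ (trans (sym (θs r)) (trans (θr r) (≤⇒≤ᵇ≡true {r} ≤-refl)))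

threshold-unique : ∀ {P r s} → Threshold P r → Threshold P s → r ≡ s
threshold-unique θr θs = ≤-antisym (threshold-≤ θs θr) (threshold-≤ θr θs)

firstTrue : (ℕ → Bool) → ℕ → ℕ
firstTrue P zero = zero
firstTrue P (suc n) with P zero
... | true  = zero
... | false = suc (firstTrue (P ∘ suc) n)

firstTrue-≤ : ∀ P n → firstTrue P n ≤ n
firstTrue-≤ P zero = z≤n
firstTrue-≤ P (suc n) with P zero
... | true  = z≤n
... | false = s≤s (firstTrue-≤ (P ∘ suc) n)

upClosed-from-zero : ∀ {P} → UpClosed P → P 0 ≡ true → ∀ a → P a ≡ true
upClosed-from-zero up P0 zero = P0
upClosed-from-zero up P0 (suc a) = up a (upClosed-from-zero up P0 a)

firstTrue-threshold : ∀ P n → UpClosed P → P n ≡ true → Threshold P (firstTrue P n)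
firstTrue-threshold P zero up Pn a = upClosed-from-zero up Pn a
firstTrue-threshold P (suc n) up Pn a with P zero in P0
firstTrue-threshold P (suc n) up Pn a       | true  = upClosed-from-zero up P0 a
firstTrue-threshold P (suc n) up Pn zero    | false = P0
firstTrue-threshold P (suc n) up Pn (suc a) | false =
  trans (firstTrue-threshold (P ∘ suc) n (up ∘ suc) Pn a) (sym (≤ᵇ-suc (firstTrue (P ∘ suc) n) a))

staircase : (ℕ → ℕ) → TermSet
staircase t a b = t b ≤ᵇ a

RowLengths : TermSet → (ℕ → ℕ) → Set
RowLengths J t = ∀ b → Threshold (λ a → J a b) (t b)

staircase-rowLengths : ∀ t → RowLengths (staircase t) t
staircase-rowLengths t b a = refl

rowLengths-unique : ∀ {I J s t} → RowLengths I s → RowLengths J t →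
                    (∀ a b → I a b ≡ J a b) → ∀ b → s b ≡ t b
rowLengths-unique ρI ρJ I≈J b = threshold-unique (λ a → trans (sym (I≈J a b)) (ρI b a)) (ρJ b)

rowLengths-injective : ∀ {I J s t} → RowLengths I s → RowLengths J t →
                       (∀ b → s b ≡ t b) → ∀ a b → I a b ≡ J a b
rowLengths-injective ρI ρJ s≈t a b = trans (ρI b a) (trans (cong (_≤ᵇ a) (s≈t b)) (sym (ρJ b a)))

boundedBy-member : ∀ {J B} → BoundedBy J B → ∀ a b → B ≤ a ⊎ B ≤ b → J a b ≡ true
boundedBy-member {J} bounded a b beyond with J a b in e | beyond
... | true  | _          = refl
... | false | inj₁ B≤a = ⊥-elim (<⇒≱ (proj₁ (bounded a b e)) B≤a)
... | false | inj₂ B≤b = ⊥-elim (<⇒≱ (proj₂ (bounded a b e)) B≤b)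

rowLengths : ∀ {J B} → IsMonomialIdeal J → BoundedBy J B → Σ (ℕ → ℕ) (RowLengths J)
rowLengths {J} {B} ideal bounded =
  (λ b → firstTrue (λ a → J a b) B) ,
  (λ b → firstTrue-threshold (λ a → J a b) B (λ a → proj₁ ∘ ideal a b)
           (boundedBy-member bounded B b (inj₁ ≤-refl)))

rowLength-≤-bound : ∀ {J B t} → BoundedBy J B → RowLengths J t → ∀ b → t b ≤ B
rowLength-≤-bound {B = B} {t} bounded ρ b =
  ≤ᵇ≡true⇒≤ {t b} (trans (sym (ρ b B)) (boundedBy-member bounded B b (inj₁ ≤-refl)))

rowLength-beyondBound : ∀ {J B t} → BoundedBy J B → RowLengths J t → t B ≡ 0
rowLength-beyondBound {B = B} bounded ρ =
  n≤0⇒n≡0 (≤ᵇ≡true⇒≤ (trans (sym (ρ B 0)) (boundedBy-member bounded 0 B (inj₂ ≤-refl))))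

StrictlyDecreasing : (ℕ → ℕ) → Set
StrictlyDecreasing t = ∀ b → 0 < t (suc b) → t (suc b) < t b

nextRow-≤ : ∀ {t a} → StrictlyDecreasing t → ∀ b → t b ≤ suc a → t (suc b) ≤ a
nextRow-≤ {t} dec b tb≤ with t (suc b) | dec b
... | zero  | _  = z≤n
... | suc k | lt = ≤-pred (≤-trans (lt (s≤s z≤n)) tb≤)

strictlyDecreasing-< : ∀ {t} → StrictlyDecreasing t → ∀ {b c} → b < c → 0 < t c → t c < t b
strictlyDecreasing-< {t} dec {b} {suc c} (s≤s b≤c) 0<tc with m≤n⇒m<n∨m≡n b≤c
... | inj₁ b<c = <-trans (dec c 0<tc) (strictlyDecreasing-< dec b<c (<-trans 0<tc (dec c 0<tc)))
... | inj₂ refl = dec c 0<tc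

staircase-isMonomialIdeal : ∀ {t} → StrictlyDecreasing t → IsMonomialIdeal (staircase t)
staircase-isMonomialIdeal {t} dec a b e =
  ≤⇒≤ᵇ≡true tb≤1+a , ≤⇒≤ᵇ≡true (nextRow-≤ dec b tb≤1+a)
  where
  tb≤1+a : t b ≤ suc a
  tb≤1+a = m≤n⇒m≤1+n (≤ᵇ≡true⇒≤ {t b} e)

staircase-isStable : ∀ {t} → StrictlyDecreasing t → IsStable (staircase t)
staircase-isStable {t} dec a b e = ≤⇒≤ᵇ≡true (nextRow-≤ dec b (≤ᵇ≡true⇒≤ {t b} e))

isStable⇒strictlyDecreasing : ∀ {J t} → RowLengths J t → IsStable J → StrictlyDecreasing t
isStable⇒strictlyDecreasing {J} {t} ρ stable b _ with t (suc b) in eq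
... | suc k = ≰⇒> λ tb≤ →
  1+n≰n (subst (_≤ k) eq (≤ᵇ≡true⇒≤ (trans (sym (ρ (suc b) k))
    (stable k b (trans (ρ b (suc k)) (≤⇒≤ᵇ≡true tb≤))))))

HasHeight : (ℕ → ℕ) → ℕ → Set
HasHeight t h = Threshold (λ b → t b ≡ᵇ 0) h

hasHeight-positive : ∀ {t h b} → HasHeight t h → b < h → 0 < t b
hasHeight-positive {t} {h} {b} η b<h with t b | η b
... | zero  | e = ⊥-elim (<⇒≱ b<h (≤ᵇ≡true⇒≤ (sym e)))
... | suc _ | _ = s≤s z≤n

hasHeight-zero : ∀ {t h b} → HasHeight t h → h ≤ b → t b ≡ 0
hasHeight-zero {t} {h} {b} η h≤b with t b | η b
... | zero  | _ = refl
... | suc _ | e = ⊥-elim (<⇒≱ (≤ᵇ≡false⇒> (sym e)) h≤b)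

hasHeight-suc : ∀ {t h} → HasHeight t (suc h) → HasHeight (t ∘ suc) h
hasHeight-suc {h = h} η b = trans (η (suc b)) (≤ᵇ-suc h b)

height : ∀ {t B} → StrictlyDecreasing t → t B ≡ 0 → Σ ℕ λ h → HasHeight t h × h ≤ B
height {t} {B} dec tB≡0 =
  firstTrue zeroRow B , firstTrue-threshold zeroRow B zeroRows-upClosed (cong (_≡ᵇ 0) tB≡0) ,
  firstTrue-≤ zeroRow B
  where
  zeroRow : ℕ → Bool
  zeroRow b = t b ≡ᵇ 0
  zeroRows-upClosed : UpClosed zeroRow
  zeroRows-upClosed b z with t b | t (suc b) | dec b
  ... | zero | zero  | _  = refl
  ... | zero | suc k | lt = ⊥-elim (<⇒≱ (lt (s≤s z≤n)) z≤n)

module _ {A : Set} (d : DecidableEquality A) where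

  runsFrom-++ : ∀ {x} ys {zs} → Disjoint (x ∷ ys) zs →
                runsFrom d x (ys ++ zs) ≡ runsFrom d x ys + runs d zs
  runsFrom-++ {x} [] {[]} _ = refl
  runsFrom-++ {x} [] {z ∷ zs} disjoint with d x z
  ... | yes x≡z = ⊥-elim (disjoint (here refl , here x≡z))
  ... | no  _   = refl
  runsFrom-++ {x} (y ∷ ys) disjoint with d x y
  ... | yes _ = runsFrom-++ ys (contractₗ disjoint)
  ... | no  _ = cong suc (runsFrom-++ ys (contractₗ disjoint))

  runs-++ : ∀ ys {zs} → Disjoint ys zs → runs d (ys ++ zs) ≡ runs d ys + runs d zs
  runs-++ [] _ = refl
  runs-++ (y ∷ ys) disjoint = cong suc (runsFrom-++ ys disjoint)

  runs-applyUpTo-injective : ∀ {f : ℕ → A} → Injective _≡_ _≡_ f → ∀ n → runs d (applyUpTo f n) ≡ n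
  runs-applyUpTo-injective {f} inj zero = refl
  runs-applyUpTo-injective {f} inj (suc n) = cong suc (runsFrom-shifted inj n)
    where
    runsFrom-shifted : ∀ {f : ℕ → A} → Injective _≡_ _≡_ f → ∀ n →
                       runsFrom d (f 0) (applyUpTo (f ∘ suc) n) ≡ n
    runsFrom-shifted {f} inj zero = refl
    runsFrom-shifted {f} inj (suc n) with d (f 0) (f 1)
    ... | yes f0≡f1 = ⊥-elim (0≢1+n (inj f0≡f1))
    ... | no  _     = cong suc (runsFrom-shifted (suc-injective ∘ inj) n)

  runs-applyUpTo-const : ∀ x {n} → 0 < n → runs d (applyUpTo (λ _ → x) n) ≡ 1
  runs-applyUpTo-const x {suc n} _ = cong suc (runsFrom-const n)
    where
    runsFrom-const : ∀ n → runsFrom d x (applyUpTo (λ _ → x) n) ≡ 0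
    runsFrom-const zero = refl
    runsFrom-const (suc n) with d x x
    ... | yes _ = runsFrom-const n
    ... | no x≢x = ⊥-elim (x≢x refl)

module _ {A B : Set} (d : DecidableEquality A) (d′ : DecidableEquality B) {f : A → B}
         (inj : Injective _≡_ _≡_ f) where

  runsFrom-map-injective : ∀ x xs → runsFrom d′ (f x) (map f xs) ≡ runsFrom d x xs
  runsFrom-map-injective x [] = refl
  runsFrom-map-injective x (y ∷ xs) with d x y | d′ (f x) (f y)
  ... | yes _   | yes _     = runsFrom-map-injective y xs
  ... | no  _   | no  _     = cong suc (runsFrom-map-injective y xs)
  ... | yes x≡y | no  fx≢fy = ⊥-elim (fx≢fy (cong f x≡y))
  ... | no  x≢y | yes fx≡fy = ⊥-elim (x≢y (inj fx≡fy))

  runs-map-injective : ∀ xs → runs d′ (map f xs) ≡ runs d xs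
  runs-map-injective [] = refl
  runs-map-injective (x ∷ xs) = cong suc (runsFrom-map-injective x xs)

applyUpTo-map-disjoint : ∀ {A B : Set} {f : ℕ → A} {g : B → A} → (∀ i y → f i ≢ g y) →
                         ∀ n ys → Disjoint (applyUpTo f n) (map g ys)
applyUpTo-map-disjoint {f = f} {g} f≢g n ys (v∈f , v∈g) with ∈-applyUpTo⁻ f v∈f | ∈-map⁻ g v∈g
... | i , _ , refl | y , _ , fi≡gy = f≢g i y fi≡gy

applyUpTo-cong : ∀ {A : Set} {f g : ℕ → A} → (∀ a → f a ≡ g a) → ∀ n → applyUpTo f n ≡ applyUpTo g n
applyUpTo-cong f≗g zero = refl
applyUpTo-cong f≗g (suc n) = cong₂ _∷_ (f≗g 0) (applyUpTo-cong (f≗g ∘ suc) n)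

concat-applyUpTo-[] : ∀ {A : Set} n → concat (applyUpTo (λ _ → []) n) ≡ ([] {A = A})
concat-applyUpTo-[] zero = refl
concat-applyUpTo-[] (suc n) = concat-applyUpTo-[] n

concat-applyUpTo-below : ∀ {A : Set} (f : ℕ → A) {r n} → r ≤ n →
                         concat (applyUpTo (λ a → if r ≤ᵇ a then [] else f a ∷ []) n) ≡ applyUpTo f r
concat-applyUpTo-below f {n = n} z≤n = concat-applyUpTo-[] n
concat-applyUpTo-below f {suc r} {suc n} (s≤s r≤n) = cong (f 0 ∷_) (begin
  concat (applyUpTo (λ a → if suc r ≤ᵇ suc a then [] else f (suc a) ∷ []) n)
    ≡⟨ cong concat (applyUpTo-cong (λ a → cong (λ c → if c then [] else f (suc a) ∷ []) (≤ᵇ-suc r a)) n) ⟩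
  concat (applyUpTo (λ a → if r ≤ᵇ a then [] else f (suc a) ∷ []) n)
    ≡⟨ concat-applyUpTo-below (f ∘ suc) r≤n ⟩
  applyUpTo (f ∘ suc) r ∎)
  where open ≡-Reasoning

threshold-listing : ∀ {A : Set} {P r n} (f : ℕ → A) → Threshold P r → r ≤ n →
                    concatMap (λ a → if P a then [] else f a ∷ []) (upTo n) ≡ applyUpTo f r
threshold-listing {P = P} {r} {n} f θ r≤n = begin
  concatMap (λ a → if P a then [] else f a ∷ []) (upTo n)
    ≡⟨ concatMap-cong (λ a → cong (λ c → if c then [] else f a ∷ []) (θ a)) (upTo n) ⟩
  concat (map select (upTo n))
    ≡⟨ cong concat (map-upTo select n) ⟩
  concat (applyUpTo select n)
    ≡⟨ concat-applyUpTo-below f r≤n ⟩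
  applyUpTo f r ∎
  where
  open ≡-Reasoning
  select : ℕ → List _
  select a = if r ≤ᵇ a then [] else f a ∷ []

rows : (ℕ → ℕ) → ℕ → List (ℕ × ℕ)
rows t B = concatMap (λ b → applyUpTo (_, b) (t b)) (upTo B)

outsideUpTo-rows : ∀ {J t B} → RowLengths J t → (∀ b → t b ≤ B) → outsideUpTo J B ≡ rows t B
outsideUpTo-rows {B = B} ρ t≤B = concatMap-cong (λ b → threshold-listing (_, b) (ρ b) (t≤B b)) (upTo B)

map₂-suc-injective : Injective _≡_ _≡_ (map₂ {A = ℕ} suc)
map₂-suc-injective e = cong₂ _,_ (cong proj₁ e) (suc-injective (cong proj₂ e))

rows-suc : ∀ t B → rows t (suc B) ≡ applyUpTo (_, 0) (t 0) ++ map (map₂ suc) (rows (t ∘ suc) B)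
rows-suc t B = cong (applyUpTo (_, 0) (t 0) ++_) (begin
  concatMap row (applyUpTo suc B)
    ≡⟨ cong (concatMap row) (map-upTo suc B) ⟨
  concatMap row (map suc (upTo B))
    ≡⟨ concatMap-map row suc (upTo B) ⟩
  concatMap (row ∘ suc) (upTo B)
    ≡⟨ concatMap-cong (λ b → map-applyUpTo (_, b) (map₂ suc) (t (suc b))) (upTo B) ⟨
  concatMap (map (map₂ suc) ∘ row′) (upTo B)
    ≡⟨ map-concatMap (map₂ suc) row′ (upTo B) ⟨
  map (map₂ suc) (rows (t ∘ suc) B) ∎)
  where
  open ≡-Reasoning
  row row′ : ℕ → List (ℕ × ℕ)
  row b = applyUpTo (_, b) (t b)
  row′ b = applyUpTo (_, b) (t (suc b))

rows-empty : ∀ {t} B → HasHeight t 0 → rows t B ≡ []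
rows-empty zero η = refl
rows-empty {t} (suc B) η = begin
  rows t (suc B)
    ≡⟨ rows-suc t B ⟩
  applyUpTo (_, 0) (t 0) ++ map (map₂ suc) (rows (t ∘ suc) B)
    ≡⟨ cong₂ (λ n L → applyUpTo (_, 0) n ++ map (map₂ suc) L)
             (hasHeight-zero {t} η z≤n) (rows-empty B (η ∘ suc)) ⟩
  [] ∎
  where open ≡-Reasoning

runs-rows : ∀ (d : DecidableEquality (ℕ × ℕ)) {t h B} → HasHeight t h → h ≤ B →
            runs d (rows t B) ≡ sum (applyUpTo t h)
runs-rows d {B = B} η z≤n = cong (runs d) (rows-empty B η)
runs-rows d {t} {suc h} {suc B} η (s≤s h≤B) = begin
  runs d (rows t (suc B))
    ≡⟨ cong (runs d) (rows-suc t B) ⟩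
  runs d (applyUpTo (_, 0) (t 0) ++ map (map₂ suc) (rows (t ∘ suc) B))
    ≡⟨ runs-++ d (applyUpTo (_, 0) (t 0)) (applyUpTo-map-disjoint (λ _ _ → 0≢1+n ∘ cong proj₂) (t 0) _) ⟩
  runs d (applyUpTo (_, 0) (t 0)) + runs d (map (map₂ suc) (rows (t ∘ suc) B))
    ≡⟨ cong₂ _+_ (runs-applyUpTo-injective d (cong proj₁) (t 0))
                 (runs-map-injective d d map₂-suc-injective _) ⟩
  t 0 + runs d (rows (t ∘ suc) B)
    ≡⟨ cong (t 0 +_) (runs-rows d (hasHeight-suc {t} η) h≤B) ⟩
  t 0 + sum (applyUpTo (t ∘ suc) h) ∎
  where open ≡-Reasoning

runs-P₂-rows : ∀ (d : DecidableEquality ℕ) {t h B} → HasHeight t h → h ≤ B →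
               runs d (map P₂ (rows t B)) ≡ h
runs-P₂-rows d {B = B} η z≤n = cong (runs d ∘ map P₂) (rows-empty B η)
runs-P₂-rows d {t} {suc h} {suc B} η (s≤s h≤B) = begin
  runs d (map P₂ (rows t (suc B)))
    ≡⟨ cong (runs d) (trans (cong (map P₂) (rows-suc t B)) (map-++ P₂ (applyUpTo (_, 0) (t 0)) _)) ⟩
  runs d (map P₂ (applyUpTo (_, 0) (t 0)) ++ map P₂ (map (map₂ suc) L))
    ≡⟨ cong (runs d) (cong₂ _++_ (map-applyUpTo (_, 0) P₂ (t 0)) (trans (sym (map-∘ L)) (map-∘ L))) ⟩
  runs d (applyUpTo (λ _ → 0) (t 0) ++ map suc (map P₂ L))
    ≡⟨ runs-++ d (applyUpTo (λ _ → 0) (t 0)) (applyUpTo-map-disjoint (λ _ _ → 0≢1+n) (t 0) _) ⟩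
  runs d (applyUpTo (λ _ → 0) (t 0)) + runs d (map suc (map P₂ L))
    ≡⟨ cong₂ _+_ (runs-applyUpTo-const d 0 (hasHeight-positive {t} η (s≤s z≤n)))
                 (runs-map-injective d d suc-injective _) ⟩
  1 + runs d (map P₂ L)
    ≡⟨ cong suc (runs-P₂-rows d (hasHeight-suc {t} η) h≤B) ⟩
  suc h ∎
  where
  open ≡-Reasoning
  L : List (ℕ × ℕ)
  L = rows (t ∘ suc) B

barList-rows : ∀ {t h B} → HasHeight t h → h ≤ B → barList (rows t B) ≡ (sum (applyUpTo t h) , h)
barList-rows {t} {B = B} η h≤B =
  cong₂ _,_ (trans (cong (runs _) (map-id (rows t B))) (runs-rows _ η h≤B)) (runs-P₂-rows _≟_ η h≤B)

rowLength-≤-area : ∀ {t} h → HasHeight t h → ∀ b → t b ≤ sum (applyUpTo t h)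
rowLength-≤-area {t} zero η b = ≤-reflexive (hasHeight-zero {t} η z≤n)
rowLength-≤-area {t} (suc h) η zero = m≤m+n (t 0) _
rowLength-≤-area {t} (suc h) η (suc b) =
  ≤-trans (rowLength-≤-area h (hasHeight-suc {t} η) b) (m≤n+m _ (t 0))

record IsStaircase (p h : ℕ) (t : ℕ → ℕ) : Set where
  field
    decreasing : StrictlyDecreasing t
    hasHeight  : HasHeight t h
    area       : sum (applyUpTo t h) ≡ p

Staircase : ℕ → ℕ → Set
Staircase p h = Σ (ℕ → ℕ) (IsStaircase p h)

StaircaseSetoid : ℕ → ℕ → Setoid 0ℓ 0ℓ
StaircaseSetoid p h = On.setoid (ℕ →-setoid ℕ) (proj₁ {B = IsStaircase p h})

rowLengthsOf : ∀ {p h} (S : StableIdeal p h) → Σ (ℕ → ℕ) (RowLengths (proj₁ S))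
rowLengthsOf (_ , ideal , _ , _ , bounded , _) = rowLengths ideal bounded

stableIdeal⇒isStaircase : ∀ {p h t} (S : StableIdeal p h) → RowLengths (proj₁ S) t → IsStaircase p h t
stableIdeal⇒isStaircase {t = t} (J , _ , stable , B , bounded , bars) ρ =
  isStaircase (height dec (rowLength-beyondBound {t = t} bounded ρ))
              (trans (cong barList (sym (outsideUpTo-rows ρ (rowLength-≤-bound bounded ρ)))) bars)
  where
  dec : StrictlyDecreasing t
  dec = isStable⇒strictlyDecreasing ρ stable
  isStaircase : ∀ {p h} → Σ ℕ (λ H → HasHeight t H × H ≤ B) →
                barList (rows t B) ≡ (p , h) → IsStaircase p h t
  -- The bar list is (area, height), so matching on refl identifies p with the area and h with the height.
  isStaircase (H , η , H≤B) bars′ with trans (sym (barList-rows η H≤B)) bars′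
  ... | refl = record { decreasing = dec ; hasHeight = η ; area = refl }

staircaseIdeal : ∀ {p h t} → IsStaircase p h t → StableIdeal p h
staircaseIdeal {p} {h} {t} st =
  staircase t , staircase-isMonomialIdeal decreasing , staircase-isStable decreasing ,
  h + p , bounded , bars
  where
  open IsStaircase st
  t≤h+p : ∀ b → t b ≤ h + p
  t≤h+p b = ≤-trans (rowLength-≤-area h hasHeight b) (≤-trans (≤-reflexive area) (m≤n+m p h))
  bounded : BoundedBy (staircase t) (h + p)
  bounded a b e = ≤-trans a<tb (t≤h+p b) , ≤-trans b<h (m≤m+n h p)
    where
    a<tb : a < t b
    a<tb = ≤ᵇ≡false⇒> e
    b<h : b < h
    b<h = ≰⇒> λ h≤b → n≮0 (subst (a <_) (hasHeight-zero {t} hasHeight h≤b) a<tb)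
  bars : barList (outsideUpTo (staircase t) (h + p)) ≡ (p , h)
  bars = trans (cong barList (outsideUpTo-rows (staircase-rowLengths t) t≤h+p))
               (trans (barList-rows hasHeight (m≤m+n h p)) (cong (_, h) area))

stableIdeal⤖staircase : ∀ {p h} → Bijection (StableIdealSetoid p h) (StaircaseSetoid p h)
stableIdeal⤖staircase {p} {h} = record
  { to        = to
  ; cong      = λ {I} {K} → to-cong {I} {K}
  ; bijective = (λ {I} {K} → rowLengths-injective (proj₂ (rowLengthsOf I)) (proj₂ (rowLengthsOf K)))
              , strictlySurjective⇒surjective (StableIdealSetoid p h) (StaircaseSetoid p h) {f = to}
                  (λ {I} {K} → to-cong {I} {K})
                  (λ (t , st) → staircaseIdeal st ,
                     rowLengths-unique (proj₂ (rowLengthsOf (staircaseIdeal st))) (staircase-rowLengths t)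
                       (λ a b → refl))
  }
  where
  to : StableIdeal p h → Staircase p h
  to S = proj₁ (rowLengthsOf S) , stableIdeal⇒isStaircase S (proj₂ (rowLengthsOf S))
  to-cong : ∀ {I K : StableIdeal p h} → (∀ a b → proj₁ I a b ≡ proj₁ K a b) →
            ∀ b → proj₁ (to I) b ≡ proj₁ (to K) b
  to-cong {I} {K} = rowLengths-unique (proj₂ (rowLengthsOf I)) (proj₂ (rowLengthsOf K))

lookupOrZero : ∀ {n} → Vec ℕ n → ℕ → ℕ
lookupOrZero []       _       = 0
lookupOrZero (x ∷ xs) zero    = x
lookupOrZero (x ∷ xs) (suc b) = lookupOrZero xs b

lookupOrZero-hasHeight : ∀ {n} (α : Vec ℕ n) → (∀ i → 0 < lookup α i) → HasHeight (lookupOrZero α) n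
lookupOrZero-hasHeight [] _ b = refl
lookupOrZero-hasHeight (x ∷ α) pos zero with x | pos fzero
... | suc _ | _ = refl
lookupOrZero-hasHeight {suc n} (x ∷ α) pos (suc b) =
  trans (lookupOrZero-hasHeight α (pos ∘ fsuc) b) (sym (≤ᵇ-suc n b))

lookupOrZero-decreasing : ∀ {n} (α : Vec ℕ n) → (∀ i j → i <ᶠ j → lookup α j < lookup α i) →
                          StrictlyDecreasing (lookupOrZero α)
lookupOrZero-decreasing [] _ b ()
lookupOrZero-decreasing (x ∷ []) _ b ()
lookupOrZero-decreasing (x ∷ y ∷ α) dec zero _ = dec fzero (fsuc fzero) (s≤s z≤n)
lookupOrZero-decreasing (x ∷ y ∷ α) dec (suc b) =
  lookupOrZero-decreasing (y ∷ α) (λ i j i<j → dec (fsuc i) (fsuc j) (s≤s i<j)) b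

lookupOrZero-tabulate : ∀ {t} h → HasHeight t h → ∀ b → lookupOrZero (tabulate {n = h} (t ∘ toℕ)) b ≡ t b
lookupOrZero-tabulate {t} zero η b = sym (hasHeight-zero {t} η z≤n)
lookupOrZero-tabulate (suc h) η zero = refl
lookupOrZero-tabulate {t} (suc h) η (suc b) = lookupOrZero-tabulate h (hasHeight-suc {t} η) b

tabulate-lookupOrZero : ∀ {n} (α : Vec ℕ n) → tabulate (lookupOrZero α ∘ toℕ) ≡ α
tabulate-lookupOrZero [] = refl
tabulate-lookupOrZero (x ∷ α) = cong (x ∷_) (tabulate-lookupOrZero α)

sum-applyUpTo-lookupOrZero : ∀ {n} (α : Vec ℕ n) → sum (applyUpTo (lookupOrZero α) n) ≡ Vec.sum α
sum-applyUpTo-lookupOrZero [] = refl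
sum-applyUpTo-lookupOrZero (x ∷ α) = cong (x +_) (sum-applyUpTo-lookupOrZero α)

sum-tabulate : ∀ (t : ℕ → ℕ) n → Vec.sum (tabulate {n = n} (t ∘ toℕ)) ≡ sum (applyUpTo t n)
sum-tabulate t zero = refl
sum-tabulate t (suc n) = cong (t 0 +_) (sum-tabulate (t ∘ suc) n)

staircase⇒distinctPartition : ∀ {p h} → Staircase p h → DistinctPartition p h
staircase⇒distinctPartition {p} {h} (t , st) = α , decreasing′ , positive , trans (sum-tabulate t h) area
  where
  open IsStaircase st
  α : Vec ℕ h
  α = tabulate (t ∘ toℕ)
  positive : ∀ i → 0 < lookup α i
  positive i rewrite lookup∘tabulate (t ∘ toℕ) i = hasHeight-positive {t} hasHeight (toℕ<n i)
  decreasing′ : ∀ i j → i <ᶠ j → lookup α j < lookup α i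
  decreasing′ i j i<j rewrite lookup∘tabulate (t ∘ toℕ) i | lookup∘tabulate (t ∘ toℕ) j =
    strictlyDecreasing-< decreasing i<j (hasHeight-positive {t} hasHeight (toℕ<n j))

distinctPartition⇒staircase : ∀ {p h} → DistinctPartition p h → Staircase p h
distinctPartition⇒staircase (α , decreasing , positive , total) = lookupOrZero α , record
  { decreasing = lookupOrZero-decreasing α decreasing
  ; hasHeight  = lookupOrZero-hasHeight α positive
  ; area       = trans (sum-applyUpTo-lookupOrZero α) total
  }

staircase⤖distinctPartition : ∀ {p h} → Bijection (StaircaseSetoid p h) (DistinctPartitionSetoid p h)
staircase⤖distinctPartition {p} {h} = record
  { to        = staircase⇒distinctPartition
  ; cong      = λ {s} {t} → to-cong {s} {t}
  ; bijective = (λ {s} {t} → injective {s} {t})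
              , strictlySurjective⇒surjective (StaircaseSetoid p h) (DistinctPartitionSetoid p h)
                  {f = staircase⇒distinctPartition} (λ {s} {t} → to-cong {s} {t})
                  (λ P → distinctPartition⇒staircase P , tabulate-lookupOrZero (proj₁ P))
  }
  where
  to-cong : ∀ {s t : Staircase p h} → (∀ b → proj₁ s b ≡ proj₁ t b) →
            proj₁ (staircase⇒distinctPartition s) ≡ proj₁ (staircase⇒distinctPartition t)
  to-cong s≈t = tabulate-cong (s≈t ∘ toℕ)
  injective : ∀ {s t : Staircase p h} →
              proj₁ (staircase⇒distinctPartition s) ≡ proj₁ (staircase⇒distinctPartition t) →
              ∀ b → proj₁ s b ≡ proj₁ t b
  injective {s , σ} {t , τ} eq b =
    trans (sym (lookupOrZero-tabulate h (IsStaircase.hasHeight σ) b))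
          (trans (cong (λ v → lookupOrZero v b) eq) (lookupOrZero-tabulate h (IsStaircase.hasHeight τ) b))

mainTheorem5 : (p h : ℕ) → 0 < p → 0 < h →
    Bijection (StableIdealSetoid p h) (DistinctPartitionSetoid p h)
mainTheorem5 p h _ _ = bijection stableIdeal⤖staircase staircase⤖distinctPartition
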